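{- For every integer $c\ge1$ there is a finite $c$-connected graph that is strongly non-stackable.
   Context: Cup stacking on a finite connected graph: initially one cup on every vertex; a move takes all $r\ge1$ cups from a vertex $x$ onto a vertex $y\neq x$ that already carries at least one cup and satisfies $d(x,y)=r$ (shortest-path distance). A graph is $t$-stackable if some sequence of moves ends with all cups on $t$; it is strongly non-stackable if it is not $t$-stackable for any vertex $t$. -}

module Defs where

open import Data.Nat using (ℕ; zero; suc; _<_; _≤_)
open import Data.Fin using (Fin)
open import Data.Fin.Subset using (Subset; _∈_; _∉_; ∣_∣)
open import Data.Product using (Σ; ∃; _×_; _,_)
open import Data.Unit using (⊤)
open import Relation.Binary.PropositionalEquality using (_≡_; _≢_)
open import Relation.Binary.Construct.Closure.ReflexiveTransitive using (Star)
open import Relation.Nullary using (¬_)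

record Graph : Set₁ where
  field
    n       : ℕ
    Adj     : Fin n → Fin n → Set
    sym     : ∀ {x y} → Adj x y → Adj y x
    irrefl  : ∀ {x} → ¬ Adj x x

module _ (G : Graph) where
  open Graph G

  data WalkIn (P : Fin n → Set) : Fin n → Fin n → ℕ → Set where
    here : ∀ {x} → P x → WalkIn P x x 0
    step : ∀ {x y z k} → P x → Adj x y → WalkIn P y z k → WalkIn P x z (suc k)

  Walk : Fin n → Fin n → ℕ → Set
  Walk = WalkIn (λ _ → ⊤)

  Dist : Fin n → Fin n → ℕ → Set
  Dist x y r = Walk x y r × (∀ k → Walk x y k → r ≤ k)

  KConnected : ℕ → Set
  KConnected c = c < n ×
    ((S : Subset n) → ∣ S ∣ < c →
      ∀ x y → x ∉ S → y ∉ S → ∃ λ k → WalkIn (λ v → v ∉ S) x y k)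

  -- Configurations: number of cups on each vertex.
  Config : Set
  Config = Fin n → ℕ

  initial : Config
  initial _ = 1

  Move : Config → Config → Set
  Move f g = Σ (Fin n) λ x → Σ (Fin n) λ y →
    x ≢ y × 1 ≤ f x × 1 ≤ f y × Dist x y (f x) ×
    g x ≡ 0 × g y ≡ Data.Nat._+_ (f y) (f x) ×
    (∀ v → v ≢ x → v ≢ y → g v ≡ f v)

  Stackable : Fin n → Set
  Stackable t = ∃ λ f → Star Move initial f × (∀ v → v ≢ t → f v ≡ 0)

  StronglyNonStackable : Set
  StronglyNonStackable = ∀ t → ¬ Stackable t

{-# OPTIONS --safe #-}
-- Take three levels j ∈ ℤ/3, each with c core vertices and a = 2c + 1 leaves; the 3c cores
-- form a clique and a leaf of level j is joined to the cores of levels j and j + 1.  This graph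
-- has diameter 2, and deleting fewer than c vertices leaves a core on every level, through
-- which all remaining vertices stay connected.
--
-- As every distance is at most 2, a pile of three or more cups can never move again.  Fix a
-- target t on level j and put k = j + 1.  Until a pile of three cups forms away from t, the
-- potential
--   #(leaves of level k holding exactly one cup) + #(cores of levels k, k + 1 not holding exactly one)
-- never decreases: a single cup leaving a counted leaf moves along an edge onto a core of
-- level k or k + 1, which then holds two cups and becomes counted, while a pile of two weighs
-- the same as an empty vertex.  The potential starts at 2c + 1, but equals 2c once all cups
-- are on t, because t itself is never counted.
module Submission where

open import Defs
open import Data.Nat using (ℕ; zero; suc; _+_; _*_; _≤_; _<_; z≤n; s≤s; _≤?_)
open import Data.Nat.Properties hiding (_≟_)
open import Algebra.Properties.CommutativeSemigroup +-commutativeSemigroup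
  using (xy∙z≈zy∙x; xy∙z≈xz∙y; xy∙z≈x∙zy)
open import Algebra.Properties.CommutativeMonoid.Sum +-0-commutativeMonoid
  using (sum; sum-cong-≗; sum-remove)
open import Data.Bool using (if_then_else_)
open import Data.Empty using (⊥; ⊥-elim)
open import Data.Fin using (Fin; zero; suc; splitAt; punchIn)
open import Data.Fin.Patterns using (0F; 1F; 2F)
open import Data.Fin.Properties using (_≟_; ¬∀⟶∃¬; punchInᵢ≢i)
open import Data.Fin.Subset using (Subset; inside; outside; _∉_; ∣_∣) renaming (⊥ to ∅)
open import Data.Fin.Subset.Properties using (_∈?_; ∣⊥∣≡0)
open import Data.Product using (∃; _×_; _,_; proj₁; proj₂)
import Data.Product as Product
open import Data.Product.Properties using (≡-dec)
open import Data.Sum using (_⊎_; inj₁; inj₂; [_,_])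
import Data.Sum as Sum
open import Data.Unit using (⊤; tt)
open import Data.Vec using ([]; _∷_)
open import Data.Vec.Functional using (Vector; replicate; _++_; updateAt)
open import Data.Vec.Functional.Properties using (updateAt-updates; updateAt-minimal)
open import Function using (_∘_; const)
open import Relation.Binary.Construct.Closure.ReflexiveTransitive using (Star; ε; _◅_)
open import Relation.Binary.Definitions using (DecidableEquality)
open import Relation.Binary.PropositionalEquality hiding ([_])
open import Relation.Nullary using (¬_; Dec; yes; no; does)
open import Relation.Nullary.Decidable using (_⊎-dec_)
open import Data.Nat.Tactic.RingSolver using (solve-∀)

sum-splitAt : ∀ p {q} (h : Fin p ⊎ Fin q → ℕ) →
  sum (h ∘ splitAt p) ≡ sum (h ∘ inj₁) + sum (h ∘ inj₂)
sum-splitAt zero    h = refl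
sum-splitAt (suc p) h =
  trans (cong (h (inj₁ zero) +_) (sum-splitAt p (h ∘ Sum.map₁ suc)))
        (sym (+-assoc (h (inj₁ zero)) _ _))

sum-const : ∀ n k → sum {n} (const k) ≡ n * k
sum-const zero    k = refl
sum-const (suc n) k = cong (k +_) (sum-const n k)

sum-mono-≤ : ∀ {n} {f g : Vector ℕ n} → (∀ i → f i ≤ g i) → sum f ≤ sum g
sum-mono-≤ {zero}  f≤g = z≤n
sum-mono-≤ {suc n} f≤g = +-mono-≤ (f≤g zero) (sum-mono-≤ (f≤g ∘ suc))

sum<sum⇒∃< : ∀ {n} {f g : Vector ℕ n} → sum f < sum g → ∃ λ i → f i < g i
sum<sum⇒∃< {n} {f} {g} Σf<Σg =
  Product.map₂ ≰⇒> (¬∀⟶∃¬ n (λ i → g i ≤ f i) (λ i → g i ≤? f i)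
                              (<⇒≱ Σf<Σg ∘ sum-mono-≤))

sum-exchange₁ : ∀ {n} {f g : Vector ℕ n} i → (∀ j → j ≢ i → f j ≡ g j) →
  sum f + g i ≡ sum g + f i
sum-exchange₁ {suc n} {f} {g} i f≡g = begin
  sum f + g i                           ≡⟨ cong (_+ g i) (sum-remove {i = i} f) ⟩
  f i + sum (f ∘ punchIn i) + g i       ≡⟨ cong (λ s → f i + s + g i) (sum-cong-≗ f≡g-off-i) ⟩
  f i + sum (g ∘ punchIn i) + g i       ≡⟨ xy∙z≈zy∙x (f i) _ (g i) ⟩
  g i + sum (g ∘ punchIn i) + f i       ≡⟨ cong (_+ f i) (sum-remove {i = i} g) ⟨
  sum g + f i                           ∎
  where
  open ≡-Reasoning
  f≡g-off-i : ∀ j → f (punchIn i j) ≡ g (punchIn i j)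
  f≡g-off-i j = f≡g (punchIn i j) (punchInᵢ≢i i j)

sum-exchange₂ : ∀ {n} {f g : Vector ℕ n} x y → x ≢ y →
  (∀ v → v ≢ x → v ≢ y → f v ≡ g v) →
  sum f + (g x + g y) ≡ sum g + (f x + f y)
sum-exchange₂ {f = f} {g} x y x≢y f≡g = begin
  sum f + (g x + g y)   ≡⟨ +-assoc (sum f) (g x) (g y) ⟨
  sum f + g x + g y     ≡⟨ cong (λ s → sum f + s + g y) hx≡gx ⟨
  sum f + h x + g y     ≡⟨ cong (_+ g y) (sum-exchange₁ x f≡h) ⟩
  sum h + f x + g y     ≡⟨ xy∙z≈xz∙y (sum h) (f x) (g y) ⟩
  sum h + g y + f x     ≡⟨ cong (_+ f x) (sum-exchange₁ y h≡g) ⟩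
  sum g + h y + f x     ≡⟨ cong (λ s → sum g + s + f x) hy≡fy ⟩
  sum g + f y + f x     ≡⟨ xy∙z≈x∙zy (sum g) (f y) (f x) ⟩
  sum g + (f x + f y)   ∎
  where
  open ≡-Reasoning
  h : Vector ℕ _
  h = updateAt f x (const (g x))
  hx≡gx : h x ≡ g x
  hx≡gx = updateAt-updates x f
  hy≡fy : h y ≡ f y
  hy≡fy = updateAt-minimal y x f (x≢y ∘ sym)
  f≡h : ∀ v → v ≢ x → f v ≡ h v
  f≡h v v≢x = sym (updateAt-minimal v x f v≢x)
  h≡g : ∀ v → v ≢ y → h v ≡ g v
  h≡g v v≢y with v ≟ x
  ... | yes refl = hx≡gx
  ... | no v≢x   = trans (sym (f≡h v v≢x)) (f≡g v v≢x v≢y)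

sum-mono-exchange₂ : ∀ {n} {f g : Vector ℕ n} x y → x ≢ y →
  (∀ v → v ≢ x → v ≢ y → f v ≡ g v) →
  f x + f y ≤ g x + g y → sum f ≤ sum g
sum-mono-exchange₂ {f = f} {g} x y x≢y f≡g le =
  +-cancelʳ-≤ (g x + g y) (sum f) (sum g) (begin
    sum f + (g x + g y)   ≡⟨ sum-exchange₂ x y x≢y f≡g ⟩
    sum g + (f x + f y)   ≤⟨ +-monoʳ-≤ (sum g) le ⟩
    sum g + (g x + g y)   ∎)
  where open ≤-Reasoning

indicator : ∀ {p} {P : Set p} → Dec P → ℕ
indicator P? = if does P? then 1 else 0

indicator<indicator : ∀ {p q} {P : Set p} {Q : Set q} (P? : Dec P) (Q? : Dec Q) →
  indicator P? < indicator Q? → ¬ P × Q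
indicator<indicator (no ¬p) (yes q) _ = ¬p , q
indicator<indicator (yes _) (yes _) (s≤s ())
indicator<indicator (yes _) (no _)  ()
indicator<indicator (no _)  (no _)  ()

∣p∣≡sum-indicator : ∀ {n} (p : Subset n) → ∣ p ∣ ≡ sum (λ i → indicator (i ∈? p))
∣p∣≡sum-indicator []            = refl
∣p∣≡sum-indicator (inside ∷ p)  = cong suc (∣p∣≡sum-indicator p)
∣p∣≡sum-indicator (outside ∷ p) = ∣p∣≡sum-indicator p

module _ (G : Graph) where
  open Graph G using (n; Adj) renaming (sym to Adj-sym)

  walk-source : ∀ {P x y k} → WalkIn G P x y k → P x
  walk-source (here px)     = px
  walk-source (step px _ _) = px

  walk-++ : ∀ {P x y z k l} → WalkIn G P x y k → WalkIn G P y z l → WalkIn G P x z (k + l)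
  walk-++ (here _)       q = q
  walk-++ (step px xy p) q = step px xy (walk-++ p q)

  walk-reverse : ∀ {P x y k} → WalkIn G P x y k → WalkIn G P y x k
  walk-reverse (here px) = here px
  walk-reverse {P} {x} {y} (step {k = k} px xz p) =
    subst (WalkIn G P y x) (+-comm k 1)
          (walk-++ (walk-reverse p) (step (walk-source p) (Adj-sym xz) (here px)))

  walk₁⇒Adj : ∀ {x y} → Walk G x y 1 → Adj x y
  walk₁⇒Adj (step _ xy (here _)) = xy

  Diameter≤2 : Set
  Diameter≤2 = ∀ x y → ∃ λ k → k ≤ 2 × Walk G x y k

  Frozen : Fin n → Config G → Set
  Frozen t f = ∃ λ v → v ≢ t × 3 ≤ f v

  module _ (diameter≤2 : Diameter≤2) where

    dist≤2 : ∀ {x y r} → Dist G x y r → r ≤ 2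
    dist≤2 {x} {y} (_ , shortest) =
      let k , k≤2 , walk = diameter≤2 x y in ≤-trans (shortest k walk) k≤2

    pile≥3-persists : ∀ {f g v} → Move G f g → 3 ≤ f v → 3 ≤ g v
    pile≥3-persists {f} {v = v} (x , y , _ , _ , _ , dist , _ , gy≡fy+fx , others) 3≤fv
      with v ≟ x | v ≟ y
    ... | yes refl | _        = ⊥-elim (<⇒≱ (s≤s (dist≤2 dist)) 3≤fv)
    ... | no _     | yes refl =
      ≤-trans 3≤fv (≤-trans (m≤m+n (f v) (f x)) (≤-reflexive (sym gy≡fy+fx)))
    ... | no v≢x   | no v≢y   = subst (3 ≤_) (sym (others v v≢x v≢y)) 3≤fv

    ¬Stackable-by-potential : ∀ t (Φ : Config G → ℕ) a →
      a ≤ Φ (initial G) →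
      (∀ {f g} → Move G f g → Frozen t g ⊎ Φ f ≤ Φ g) →
      (∀ f → (∀ v → v ≢ t → f v ≡ 0) → Φ f < a) →
      ¬ Stackable G t
    ¬Stackable-by-potential t Φ a a≤Φ₀ Φ-move Φ-stacked (f , moves , stacked) =
      refuted (invariant moves (inj₂ a≤Φ₀))
      where
      Invariant : Config G → Set
      Invariant f = Frozen t f ⊎ a ≤ Φ f

      invariant : ∀ {f g} → Star (Move G) f g → Invariant f → Invariant g
      invariant ε inv = inv
      invariant (move ◅ moves) (inj₁ (v , v≢t , 3≤fv)) =
        invariant moves (inj₁ (v , v≢t , pile≥3-persists move 3≤fv))
      invariant (move ◅ moves) (inj₂ a≤Φf) =
        invariant moves (Sum.map₂ (≤-trans a≤Φf) (Φ-move move))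

      refuted : ¬ Invariant f
      refuted (inj₁ (v , v≢t , 3≤fv)) = <⇒≱ (s≤s z≤n) (subst (3 ≤_) (stacked v v≢t) 3≤fv)
      refuted (inj₂ a≤Φf)             = <⇒≱ (Φ-stacked f stacked) a≤Φf

data Role : Set where
  ifOne unlessOne never : Role

weight : Role → ℕ → ℕ
weight ifOne     1 = 1
weight ifOne     _ = 0
weight unlessOne 1 = 0
weight unlessOne _ = 1
weight never     _ = 0

Linked : Role → Role → Set
Linked ρ σ = ρ ≡ ifOne → σ ≡ unlessOne

weight-move-one-onto-one : ∀ ρx ρy → Linked ρx ρy → Linked ρy ρx →
  weight ρx 1 + weight ρy 1 ≤ weight ρx 0 + weight ρy 2
weight-move-one-onto-one ifOne     ρy        xy yx with xy refl
... | refl = ≤-refl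
weight-move-one-onto-one unlessOne ifOne     xy yx = ≤-refl
weight-move-one-onto-one unlessOne unlessOne xy yx = z≤n
weight-move-one-onto-one unlessOne never     xy yx = z≤n
weight-move-one-onto-one never     ifOne     xy yx with yx refl
... | ()
weight-move-one-onto-one never     unlessOne xy yx = z≤n
weight-move-one-onto-one never     never     xy yx = z≤n

weight-move-onto-never : ∀ ρ r → 1 ≤ r → r ≤ 2 → (r ≡ 1 → Linked ρ never) →
  weight ρ r ≤ weight ρ 0
weight-move-onto-never ρ         0 () _ _
weight-move-onto-never ifOne     1 _ _ linked with linked refl refl
... | ()
weight-move-onto-never ifOne     2 _ _ _ = z≤n
weight-move-onto-never unlessOne 1 _ _ _ = z≤n
weight-move-onto-never unlessOne 2 _ _ _ = ≤-refl
weight-move-onto-never never     r _ _ _ = z≤n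
weight-move-onto-never ρ (suc (suc (suc r))) _ (s≤s (s≤s ())) _

both-one : ∀ {r s} → 1 ≤ r → 1 ≤ s → s + r < 3 → r ≡ 1 × s ≡ 1
both-one {r} {s} 1≤r 1≤s s+r<3 =
  ≤-antisym (≤-pred (≤-trans (+-monoˡ-≤ r 1≤s) s+r≤2)) 1≤r ,
  ≤-antisym (+-cancelʳ-≤ 1 s 1 (≤-trans (+-monoʳ-≤ s 1≤r) s+r≤2)) 1≤s
  where
  s+r≤2 : s + r ≤ 2
  s+r≤2 = ≤-pred s+r<3

Level : Set
Level = Fin 3

next : Level → Level
next 0F = 1F
next 1F = 2F
next 2F = 0F

Covers : Level → Level → Set
Covers j l = l ≡ j ⊎ l ≡ next j

covers? : ∀ j l → Dec (Covers j l)
covers? j l = (l ≟ j) ⊎-dec (l ≟ next j)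

¬covers-previous : ∀ j → ¬ Covers (next j) j
¬covers-previous 0F (inj₁ ())
¬covers-previous 0F (inj₂ ())
¬covers-previous 1F (inj₁ ())
¬covers-previous 1F (inj₂ ())
¬covers-previous 2F (inj₁ ())
¬covers-previous 2F (inj₂ ())

shared-cover : ∀ j l → ∃ λ m → Covers j m × Covers l m
shared-cover 0F 0F = 0F , inj₁ refl , inj₁ refl
shared-cover 0F 1F = 1F , inj₂ refl , inj₁ refl
shared-cover 0F 2F = 0F , inj₁ refl , inj₂ refl
shared-cover 1F 0F = 1F , inj₁ refl , inj₂ refl
shared-cover 1F 1F = 1F , inj₁ refl , inj₁ refl
shared-cover 1F 2F = 2F , inj₂ refl , inj₁ refl
shared-cover 2F 0F = 0F , inj₂ refl , inj₁ refl
shared-cover 2F 1F = 2F , inj₁ refl , inj₂ refl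
shared-cover 2F 2F = 2F , inj₁ refl , inj₁ refl

data Kind : Set where
  core leaf : Kind

_≟ᴷ_ : DecidableEquality Kind
core ≟ᴷ core = yes refl
core ≟ᴷ leaf = no λ ()
leaf ≟ᴷ core = no λ ()
leaf ≟ᴷ leaf = yes refl

Class : Set
Class = Level × Kind

_≟ᶜ_ : DecidableEquality Class
_≟ᶜ_ = ≡-dec _≟_ _≟ᴷ_

Compatible : Class → Class → Set
Compatible (_ , core) (_ , core) = ⊤
Compatible (l , core) (j , leaf) = Covers j l
Compatible (j , leaf) (l , core) = Covers j l
Compatible (_ , leaf) (_ , leaf) = ⊥

Compatible-sym : ∀ u v → Compatible u v → Compatible v u
Compatible-sym (_ , core) (_ , core) uv = uv
Compatible-sym (_ , core) (_ , leaf) uv = uv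
Compatible-sym (_ , leaf) (_ , core) uv = uv

role : Level → Class → Role
role k (j , leaf) with j ≟ k
... | yes _ = ifOne
... | no _  = never
role k (l , core) with covers? k l
... | yes _ = unlessOne
... | no _  = never

role-ifOne : ∀ k u → role k u ≡ ifOne → u ≡ (k , leaf)
role-ifOne k (j , leaf) ρ≡ifOne with j ≟ k
... | yes refl = refl
role-ifOne k (j , leaf) () | no _
role-ifOne k (l , core) ρ≡ifOne with covers? k l
role-ifOne k (l , core) () | yes _
role-ifOne k (l , core) () | no _

role-previous : ∀ u → role (next (proj₁ u)) u ≡ never
role-previous (j , leaf) with j ≟ next j
... | yes j≡next-j = ⊥-elim (¬covers-previous j (inj₁ j≡next-j))
... | no _         = refl
role-previous (j , core) with covers? (next j) j
... | yes covers = ⊥-elim (¬covers-previous j covers)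
... | no _       = refl

Compatible⇒Linked : ∀ k u v → Compatible u v → Linked (role k u) (role k v)
Compatible⇒Linked k u v uv ρu≡ifOne with role-ifOne k u ρu≡ifOne
Compatible⇒Linked k _ (l , core) k≺l _ | refl with covers? k l
... | yes _     = refl
... | no ¬k≺l   = ⊥-elim (¬k≺l k≺l)

module Construction (c : ℕ) (1≤c : 1 ≤ c) where

  a : ℕ
  a = suc (c + c)

  levelSize : ℕ
  levelSize = c + a

  order : ℕ
  order = levelSize + (levelSize + levelSize)

  level : Level → Vector Class levelSize
  level j = replicate c (j , core) ++ replicate a (j , leaf)

  class : Vector Class order
  class = level 0F ++ (level 1F ++ level 2F)

  coreTotal leafTotal : (Class → ℕ) → ℕ
  coreTotal h = sum (λ j → h (j , core))
  leafTotal h = sum (λ j → h (j , leaf))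

  sum-by-class : ∀ (h : Class → ℕ) → sum (h ∘ class) ≡ c * coreTotal h + a * leafTotal h
  sum-by-class h = begin
    sum (h ∘ class)
      ≡⟨ sum-splitAt levelSize (h ∘ [ level 0F , level 1F ++ level 2F ]) ⟩
    sum (h ∘ level 0F) + sum (h ∘ (level 1F ++ level 2F))
      ≡⟨ cong (sum (h ∘ level 0F) +_) (sum-splitAt levelSize (h ∘ [ level 1F , level 2F ])) ⟩
    sum (h ∘ level 0F) + (sum (h ∘ level 1F) + sum (h ∘ level 2F))
      ≡⟨ cong₂ _+_ (sum-level 0F) (cong₂ _+_ (sum-level 1F) (sum-level 2F)) ⟩
    (c * h (0F , core) + a * h (0F , leaf)) +
      ((c * h (1F , core) + a * h (1F , leaf)) + (c * h (2F , core) + a * h (2F , leaf)))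
      ≡⟨ regroup c a _ _ _ _ _ _ ⟩
    c * coreTotal h + a * leafTotal h ∎
    where
    open ≡-Reasoning
    sum-level : ∀ j → sum (h ∘ level j) ≡ c * h (j , core) + a * h (j , leaf)
    sum-level j = trans (sum-splitAt c (h ∘ [ replicate c (j , core) , replicate a (j , leaf) ]))
                        (cong₂ _+_ (sum-const c _) (sum-const a _))
    regroup : ∀ c a x₀ y₀ x₁ y₁ x₂ y₂ →
      (c * x₀ + a * y₀) + ((c * x₁ + a * y₁) + (c * x₂ + a * y₂)) ≡
      c * (x₀ + (x₁ + (x₂ + 0))) + a * (y₀ + (y₁ + (y₂ + 0)))
    regroup = solve-∀

  count-core : ∀ j → sum (λ v → indicator (class v ≟ᶜ (j , core))) ≡ c
  count-core j = trans (sum-by-class (λ u → indicator (u ≟ᶜ (j , core)))) (by-level j)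
    where
    c*1+a*0≡c : ∀ c a → c * 1 + a * 0 ≡ c
    c*1+a*0≡c = solve-∀
    by-level : ∀ l → let h = λ u → indicator (u ≟ᶜ (l , core)) in
      c * coreTotal h + a * leafTotal h ≡ c
    by-level 0F = c*1+a*0≡c c a
    by-level 1F = c*1+a*0≡c c a
    by-level 2F = c*1+a*0≡c c a

  core-survives : (R : Subset order) → ∣ R ∣ < c → ∀ j → ∃ λ v → v ∉ R × class v ≡ (j , core)
  core-survives R ∣R∣<c j =
    let v , fewer = sum<sum⇒∃< (subst₂ _<_ (∣p∣≡sum-indicator R) (sym (count-core j)) ∣R∣<c)
    in  v , indicator<indicator (v ∈? R) (class v ≟ᶜ (j , core)) fewer

  core-at : ∀ j → ∃ λ v → class v ≡ (j , core)
  core-at j = Product.map₂ proj₂ (core-survives ∅ (subst (_< c) (sym (∣⊥∣≡0 order)) 1≤c) j)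

  Adjacent : Fin order → Fin order → Set
  Adjacent x y = x ≢ y × Compatible (class x) (class y)

  graph : Graph
  graph = record
    { n      = order
    ; Adj    = Adjacent
    ; sym    = λ {x} {y} (x≢y , xy) → x≢y ∘ sym , Compatible-sym (class x) (class y) xy
    ; irrefl = λ (x≢x , _) → x≢x refl
    }

  edge : ∀ {P x y u v} → class x ≡ u → class y ≡ v → P x → P y → x ≢ y → Compatible u v →
    WalkIn graph P x y 1
  edge refl refl px py x≢y uv = step px (x≢y , uv) (here py)

  distinct : ∀ {x y u v} → class x ≡ u → class y ≡ v → u ≢ v → x ≢ y
  distinct refl refl u≢v refl = u≢v refl

  walk-leaf-core : ∀ {x y j l} → class x ≡ (j , leaf) → class y ≡ (l , core) →
    ∃ λ k → k ≤ 2 × Walk graph x y k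
  walk-leaf-core {j = j} {l} ex ey with covers? j l
  ... | yes j≺l = 1 , s≤s z≤n , edge ex ey tt tt (distinct ex ey λ ()) j≺l
  ... | no j⊀l  =
    let w , ew = core-at j
    in  2 , ≤-refl , walk-++ graph (edge ex ew tt tt (distinct ex ew λ ()) (inj₁ refl))
                                   (edge ew ey tt tt (distinct ew ey λ { refl → j⊀l (inj₁ refl) }) tt)

  diameter≤2 : Diameter≤2 graph
  diameter≤2 x y with x ≟ y | class x in ex | class y in ey
  ... | yes refl | _          | _          = 0 , z≤n , here tt
  ... | no x≢y   | (_ , core) | (_ , core) = 1 , s≤s z≤n , edge ex ey tt tt x≢y tt
  ... | no _     | (_ , leaf) | (_ , core) = walk-leaf-core ex ey
  ... | no _     | (_ , core) | (_ , leaf) =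
    Product.map₂ (Product.map₂ (walk-reverse graph)) (walk-leaf-core ey ex)
  ... | no _     | (j , leaf) | (l , leaf) =
    let s , j≺s , l≺s = shared-cover j l
        w , ew = core-at s
    in  2 , ≤-refl , walk-++ graph (edge ex ew tt tt (distinct ex ew λ ()) j≺s)
                                   (edge ew ey tt tt (distinct ew ey λ ()) l≺s)

  c<order : c < order
  c<order = ≤-trans (m<m+n c (s≤s z≤n)) (m≤m+n levelSize (levelSize + levelSize))

  walk-to-level-0-core : ∀ {R h r} → h ∉ R → class h ≡ (0F , core) →
    r ∉ R → class r ≡ (1F , core) → ∀ z → z ∉ R → ∃ λ k → WalkIn graph (_∉ R) z h k
  walk-to-level-0-core {h = h} h∉R eh r∉R er z z∉R with z ≟ h | class z in ez
  ... | yes refl | _           = 0 , here z∉R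
  ... | no z≢h   | (_ , core)  = 1 , edge ez eh z∉R h∉R z≢h tt
  ... | no z≢h   | (0F , leaf) = 1 , edge ez eh z∉R h∉R z≢h (inj₁ refl)
  ... | no z≢h   | (2F , leaf) = 1 , edge ez eh z∉R h∉R z≢h (inj₂ refl)
  ... | no _     | (1F , leaf) =
    2 , walk-++ graph (edge ez er z∉R r∉R (distinct ez er λ ()) (inj₁ refl))
                      (edge er eh r∉R h∉R (distinct er eh λ ()) tt)

  connected-avoiding : (R : Subset order) → ∣ R ∣ < c →
    ∀ x y → x ∉ R → y ∉ R → ∃ λ k → WalkIn graph (_∉ R) x y k
  connected-avoiding R ∣R∣<c x y x∉R y∉R =
    let h , h∉R , eh = core-survives R ∣R∣<c 0F
        r , r∉R , er = core-survives R ∣R∣<c 1F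
        k , x⇝h = walk-to-level-0-core h∉R eh r∉R er x x∉R
        l , y⇝h = walk-to-level-0-core h∉R eh r∉R er y y∉R
    in  k + l , walk-++ graph x⇝h (walk-reverse graph y⇝h)

  connected : KConnected graph c
  connected = c<order , connected-avoiding

  module Potential (t : Fin order) where

    k : Level
    k = next (proj₁ (class t))

    ρ : Fin order → Role
    ρ v = role k (class v)

    Φ : Config graph → ℕ
    Φ f = sum (λ v → weight (ρ v) (f v))

    ρ-target : ρ t ≡ never
    ρ-target = role-previous (class t)

    weight-target : ∀ r → weight (ρ t) r ≡ 0
    weight-target r = cong (λ σ → weight σ r) ρ-target

    Φ-initial : Φ (initial graph) ≡ a
    Φ-initial = trans (sum-by-class (λ u → weight (role k u) 1)) (by-level k)
      where
      c*0+a*1≡a : ∀ c a → c * 0 + a * 1 ≡ a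
      c*0+a*1≡a = solve-∀
      by-level : ∀ l → let h = λ u → weight (role l u) 1 in
        c * coreTotal h + a * leafTotal h ≡ a
      by-level 0F = c*0+a*1≡a c a
      by-level 1F = c*0+a*1≡a c a
      by-level 2F = c*0+a*1≡a c a

    Φ-empty : Φ (const 0) < a
    Φ-empty = ≤-reflexive (cong suc (trans (sum-by-class (λ u → weight (role k u) 0)) (by-level k)))
      where
      c*2+a*0≡c+c : ∀ c a → c * 2 + a * 0 ≡ c + c
      c*2+a*0≡c+c = solve-∀
      by-level : ∀ l → let h = λ u → weight (role l u) 0 in
        c * coreTotal h + a * leafTotal h ≡ c + c
      by-level 0F = c*2+a*0≡c+c c a
      by-level 1F = c*2+a*0≡c+c c a
      by-level 2F = c*2+a*0≡c+c c a

    Φ-stacked : ∀ f → (∀ v → v ≢ t → f v ≡ 0) → Φ f < a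
    Φ-stacked f stacked = subst (_< a) (sym (sum-cong-≗ emptied)) Φ-empty
      where
      emptied : ∀ v → weight (ρ v) (f v) ≡ weight (ρ v) 0
      emptied v with v ≟ t
      ... | yes refl = trans (weight-target (f t)) (sym (weight-target 0))
      ... | no v≢t   = cong (weight (ρ v)) (stacked v v≢t)

    Gain : Fin order → Fin order → ℕ → ℕ → Set
    Gain x y r s = weight (ρ x) r + weight (ρ y) s ≤ weight (ρ x) 0 + weight (ρ y) (s + r)

    linked-at-distance-1 : ∀ {x y} → Dist graph x y 1 → Linked (ρ x) (ρ y) × Linked (ρ y) (ρ x)
    linked-at-distance-1 (walk , _) =
      let _ , xy = walk₁⇒Adj graph walk
      in  Compatible⇒Linked _ _ _ xy , Compatible⇒Linked _ _ _ (Compatible-sym _ _ xy)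

    gain-onto-target : ∀ {x r} s → 1 ≤ r → Dist graph x t r → Gain x t r s
    gain-onto-target {x} {r} s 1≤r dist =
      +-mono-≤ (weight-move-onto-never (ρ x) r 1≤r (dist≤2 graph diameter≤2 dist) linked-to-target)
               (≤-reflexive (trans (weight-target s) (sym (weight-target (s + r)))))
      where
      linked-to-target : r ≡ 1 → Linked (ρ x) never
      linked-to-target refl = subst (Linked (ρ x)) ρ-target (proj₁ (linked-at-distance-1 dist))

    gain-one-onto-one : ∀ {x y} → Dist graph x y 1 → Gain x y 1 1
    gain-one-onto-one {x} {y} dist =
      let x→y , y→x = linked-at-distance-1 dist
      in  weight-move-one-onto-one (ρ x) (ρ y) x→y y→x

    Φ-exchange : ∀ {f g : Config graph} x y → x ≢ y → g x ≡ 0 → g y ≡ f y + f x →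
      (∀ v → v ≢ x → v ≢ y → g v ≡ f v) → Gain x y (f x) (f y) → Φ f ≤ Φ g
    Φ-exchange {f} {g} x y x≢y gx≡0 gy≡fy+fx others gain =
      sum-mono-exchange₂ x y x≢y (λ v v≢x v≢y → cong (weight (ρ v)) (sym (others v v≢x v≢y)))
        (subst₂ (λ gx gy → weight (ρ x) (f x) + weight (ρ y) (f y) ≤
                           weight (ρ x) gx + weight (ρ y) gy)
                (sym gx≡0) (sym gy≡fy+fx) gain)

    Φ-move : ∀ {f g} → Move graph f g → Frozen graph t g ⊎ Φ f ≤ Φ g
    Φ-move {f} {g} (x , y , x≢y , 1≤fx , 1≤fy , dist , gx≡0 , gy≡fy+fx , others)
      with y ≟ t | 3 ≤? g y
    ... | no y≢t   | yes 3≤gy = inj₁ (y , y≢t , 3≤gy)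
    ... | yes refl | _        =
      inj₂ (Φ-exchange x y x≢y gx≡0 gy≡fy+fx others (gain-onto-target (f y) 1≤fx dist))
    ... | no _     | no gy≱3  =
      let fx≡1 , fy≡1 = both-one 1≤fx 1≤fy (subst (_< 3) gy≡fy+fx (≰⇒> gy≱3))
      in  inj₂ (Φ-exchange x y x≢y gx≡0 gy≡fy+fx others
                  (subst₂ (Gain x y) (sym fx≡1) (sym fy≡1)
                          (gain-one-onto-one (subst (Dist graph x y) fx≡1 dist))))

  strongly-non-stackable : StronglyNonStackable graph
  strongly-non-stackable t =
    ¬Stackable-by-potential graph diameter≤2 t Φ a (≤-reflexive (sym Φ-initial)) Φ-move Φ-stacked
    where open Potential t

theorem4p4 : (c : ℕ) → 1 ≤ c → ∃ λ (G : Graph) → KConnected G c × StronglyNonStackable G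
theorem4p4 c 1≤c = graph , connected , strongly-non-stackable
  where open Construction c 1≤c
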